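{- Let $\mathcal{P}$ be the output of Algorithm LAP (defined in the context) with threshold $\rho\ge 1$ on real instance $\mathcal{J}$ and prediction $\hat{\mathcal{J}}$, and let $t_\lambda$ be such that $t_\lambda-1$ is the last time $t\in[T]$ for which $W(\textsc{Opt}(\mathcal{J}_{\le t})^{(\le t)})/W(\mathcal{P}^{(\le t)})\le\rho$. If $W(\textsc{Opt}(\mathcal{J})^{(\le t_\lambda-1)})>W(\textsc{Opt}(\mathcal{J}_{\le t_\lambda-1})^{(\le t_\lambda-1)})$, then $\textsc{Opt}(\mathcal{J})^{(\le t_\lambda-1)}\cap\textsc{Opt}(\mathcal{J}_{\le t_\lambda-1})^{(>t_\lambda-1)}\ne\emptyset$.
   Context: Problem: an instance is a collection $\mathcal{J}$ of unit-length jobs $j=(r_j,d_j,w_j)$ (integer release time, integer deadline, nonnegative weight, all weights distinct), revealed online at their release times. Time is discrete with horizon $T$, $[T]$ the set of time steps; at each time $t$ at most one job is processed and job $j$ may be processed at $t$ only if $r_j\le t\le d_j-1$; the goal is to maximize total processed weight. For a schedule $\mathcal{S}$: $W$ is total weight, $\mathcal{S}^{(t)}$ the job processed at time $t$, $\mathcal{S}^{(\le t)}$ the jobs processed in $[0,t]$, $\mathcal{S}^{(>t)}$ the jobs processed after time $t$ (zero-weight dummy jobs when nothing is processed). $\mathcal{J}_{\le t}$: jobs with release time $\le t$. $\mathcal{D}(t,\mathcal{J})$: jobs with $d_j<t+1$ not yet processed. Job $j$ dominates $j'$ if $w_j>w_{j'}$ and $d_j\le d_{j'}$; a canonical schedule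 processes at each step the earliest-deadline released, unprocessed, undominated job among its jobs; $\textsc{Opt}(\mathcal{I})$ is a canonical optimal schedule for instance $\mathcal{I}$. The algorithm receives at time $0$ a predicted instance $\hat{\mathcal{J}}$. A set of choices $\mathcal{S}=(\mathcal{S}_1,\dots,\mathcal{S}_T)$ specifies which job to process at each time; $\mathcal{S}(\mathcal{J})$ is the schedule of jobs of $\mathcal{J}$ obtained by following these choices (zero-weight dummy jobs when there is no corresponding job). Algorithm LAP: input $\hat{\mathcal{J}}$, an online algorithm $\textsc{OnlineAlg}$ for the problem (without predictions), and threshold $\rho\ge1$. It computes the choices $\hat{\mathcal{S}}$ of an optimal schedule for $\hat{\mathcal{J}}$ ($\hat{\mathcal{S}}(\hat{\mathcal{J}})=\textsc{Opt}(\hat{\mathcal{J}})$), sets $\mathcal{P}=\emptyset$, and for each time $t$: if $\hat{\mathcal{S}}(\mathcal{J})^{(t)}\notin\mathcal{P}$ and $W(\textsc{Opt}(\mathcal{J}_{\le t})^{(\le t)})/W(\mathcal{P}\cup\{\hat{\mathcal{S}}(\mathcal{J})^{(t)}\})\le\rho$, it processes $\hat{\mathcal{S}}(\mathcal{J})^{(t)}$ (adds it to $\mathcal{P}$); otherwise it processes (adds to $\mathcal{P}$) the job $\textsc{OnlineAlg}(\mathcal{J}\setminus(\mathcal{P}\cup\mathcal{D}(t,\mathcal{J})))^{(t)}$ that $\textsc{OnlineAlg}$ processes at time $t$ on the remaining unprocessed, unexpired jobs. It returns $\mathcal{P}$.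
   Formalization: The job weights are rational rather than real, and the threshold ρ is a rational number. -}

module Defs where

open import Data.Nat as ℕ using (ℕ; zero; suc)
open import Data.Rational as ℚ using (ℚ; 0ℚ; 1ℚ)
open import Data.Maybe using (Maybe; just; nothing)
open import Data.List using (List; []; _∷_; _++_; [_]; catMaybes; foldr; filterᵇ)
open import Data.Bool using (Bool; true; false; if_then_else_; _∧_; not; _∨_)
open import Data.Product using (Σ; _×_; _,_; ∃)
open import Relation.Nullary using (¬_; Dec; yes; no; does)
open import Relation.Binary.Definitions using (DecidableEquality)
open import Relation.Binary.PropositionalEquality using (_≡_; refl)
open import Data.List.Membership.Propositional using (_∈_)
open import Data.List.Relation.Unary.All using (All)
open import Data.List.Relation.Unary.AllPairs using (AllPairs)

-- A unit job (r_j, d_j, w_j).  Real and predicted jobs are identified by this triple.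
record Job : Set where
  constructor job
  field
    r : ℕ
    d : ℕ
    w : ℚ
open Job public

_≟J_ : DecidableEquality Job
job r₁ d₁ w₁ ≟J job r₂ d₂ w₂ with r₁ ℕ.≟ r₂ | d₁ ℕ.≟ d₂ | w₁ ℚ.≟ w₂
... | yes refl | yes refl | yes refl = yes refl
... | no p | _ | _ = no λ { refl → p refl }
... | yes _ | no p | _ = no λ { refl → p refl }
... | yes _ | yes _ | no p = no λ { refl → p refl }

_∈ᵇ_ : Job → List Job → Bool
j ∈ᵇ [] = false
j ∈ᵇ (k ∷ ks) = does (j ≟J k) ∨ (j ∈ᵇ ks)

WellFormed : List Job → Set
WellFormed I = All (λ j → 0ℚ ℚ.≤ w j) I × AllPairs (λ a b → ¬ (w a ≡ w b)) I

released≤ : ℕ → List Job → List Job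
released≤ t = filterᵇ (λ j → does (r j ℕ.≤? t))

-- A schedule: the job processed at each time step (nothing = dummy / idle).
Schedule : Set
Schedule = ℕ → Maybe Job

wt : Maybe Job → ℚ
wt nothing = 0ℚ
wt (just j) = w j

Wbelow : Schedule → ℕ → ℚ
Wbelow S zero = 0ℚ
Wbelow S (suc n) = Wbelow S n ℚ.+ wt (S n)

Wle : Schedule → ℕ → ℚ
Wle S t = Wbelow S (suc t)

Wtot : ℕ → Schedule → ℚ
Wtot T S = Wbelow S T

Wlist : List Job → ℚ
Wlist = foldr (λ j acc → w j ℚ.+ acc) 0ℚ

Valid : ℕ → List Job → Schedule → Set
Valid T I S =
  (∀ t j → S t ≡ just j → (j ∈ I) × (r j ℕ.≤ t) × (t ℕ.< d j) × (t ℕ.< T))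
  × (∀ t t' j → S t ≡ just j → S t' ≡ just j → t ≡ t')

Optimal : ℕ → List Job → Schedule → Set
Optimal T I S = Valid T I S × (∀ S' → Valid T I S' → Wtot T S' ℚ.≤ Wtot T S)

Dominates : Job → Job → Set
Dominates a b = (w b ℚ.< w a) × (d a ℕ.≤ d b)

Pending : ℕ → Schedule → ℕ → Job → Set
Pending T S t j = (Σ ℕ λ t' → (t ℕ.≤ t') × (t' ℕ.< T) × (S t' ≡ just j)) × (r j ℕ.≤ t)

Undominated : ℕ → Schedule → ℕ → Job → Set
Undominated T S t j = Pending T S t j × (∀ j' → Pending T S t j' → ¬ Dominates j' j)

Canonical : ℕ → Schedule → Set
Canonical T S = ∀ t → t ℕ.< T →
  (∀ j → S t ≡ just j →
     Undominated T S t j × (∀ j' → Undominated T S t j' → d j ℕ.≤ d j'))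
  × (S t ≡ nothing → ∀ j' → ¬ Undominated T S t j')

CanonOpt : ℕ → List Job → Schedule → Set
CanonOpt T I S = Optimal T I S × Canonical T S

OnlineAlg : ℕ → (List Job → Schedule) → Set
OnlineAlg T A =
  (∀ I → Valid T I (A I))
  × (∀ I I' t → released≤ t I ≡ released≤ t I' → ∀ t' → t' ℕ.≤ t → A I t' ≡ A I' t')

follow : Schedule → List Job → Schedule
follow Ŝ J t with Ŝ t
... | nothing = nothing
... | just j = if j ∈ᵇ J then just j else nothing

notInᵇ : Maybe Job → List Job → Bool
notInᵇ nothing P = true
notInᵇ (just j) P = not (j ∈ᵇ P)

-- Parameters: real instance J, choices Ŝ (of Opt(Ĵ)),
-- online algorithm A, family optS with optS t = Opt(J_{≤t}), threshold ρ.
-- `hist` is the list of decisions at times 0 … t-1; P = processed jobs so far.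
lapDecide : List Job → Schedule → (List Job → Schedule) → (ℕ → Schedule) → ℚ
          → ℕ → List (Maybe Job) → Maybe Job
lapDecide J Ŝ A optS ρ t hist =
  if notInᵇ x P ∧ does (Wle (optS t) t ℚ.≤? ρ ℚ.* (Wlist P ℚ.+ wt x))
  then x
  else A (filterᵇ (λ j → not (j ∈ᵇ P) ∧ does (t ℕ.<? d j)) J) t
  where
    P : List Job
    P = catMaybes hist
    x : Maybe Job
    x = follow Ŝ J t

lapHist : List Job → Schedule → (List Job → Schedule) → (ℕ → Schedule) → ℚ
        → ℕ → List (Maybe Job)
lapHist J Ŝ A optS ρ zero = []
lapHist J Ŝ A optS ρ (suc n) =
  lapHist J Ŝ A optS ρ n ++ [ lapDecide J Ŝ A optS ρ n (lapHist J Ŝ A optS ρ n) ]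

LAP : List Job → Schedule → (List Job → Schedule) → (ℕ → Schedule) → ℚ → Schedule
LAP J Ŝ A optS ρ t = lapDecide J Ŝ A optS ρ t (lapHist J Ŝ A optS ρ t)

-- If no job that Opt(J) runs by time τ is run by Opt(J_{≤τ}) after τ, then the schedule running
-- Opt(J) up to τ and Opt(J_{≤τ}) afterwards is feasible for J_{≤τ}: its early jobs are released by τ
-- and no job is run twice.  Optimality of Opt(J_{≤τ}) then bounds W(Opt(J)^{(≤τ)}) by
-- W(Opt(J_{≤τ})^{(≤τ)}), contradicting the hypothesis; since the search for a shared job is
-- bounded, the contradiction yields an explicit job.
module Submission where

open import Defs
open import Data.Nat using (ℕ; _≤_; _<_)
open import Data.Rational using (ℚ; 1ℚ; _*_) renaming (_≤_ to _≤ℚ_; _<_ to _<ℚ_)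
open import Data.Maybe using (Maybe; just)
open import Data.List using (List)
open import Data.Product using (Σ; _×_)
open import Relation.Nullary using (¬_)
open import Relation.Binary.PropositionalEquality using (_≡_)

open import Data.Nat as ℕ using (zero; suc; _∸_; _≤?_; _<?_; s≤s)
import Data.Nat.Properties as ℕ
open import Data.Rational using (_+_)
import Data.Rational.Properties as ℚ
open import Data.Maybe using (nothing)
import Data.Maybe.Properties as Maybe
open import Data.List.Membership.Propositional using (_∈_)
open import Data.List.Membership.Propositional.Properties using (∈-filter⁺)
open import Data.Product using (_,_; ∃; proj₁; proj₂)
open import Data.Empty using (⊥-elim)
open import Function using (_∘_)
open import Relation.Nullary using (Dec; yes; no; does)
open import Relation.Nullary.Decidable using (T?; _×-dec_)
open import Relation.Binary.PropositionalEquality using (refl; sym; cong; cong₂; subst; module ≡-Reasoning)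

∈-released≤ : ∀ {t j} (I : List Job) → j ∈ I → r j ≤ t → j ∈ released≤ t I
∈-released≤ {t} I j∈I r≤t = ∈-filter⁺ (T? ∘ λ k → does (r k ≤? t)) j∈I (ℕ.≤⇒≤ᵇ r≤t)

+-cancelˡ-≤ : ∀ a b c → c + a ≤ℚ c + b → a ≤ℚ b
+-cancelˡ-≤ a b c ca≤cb = ℚ.≮⇒≥ λ b<a → ℚ.<-irrefl refl (ℚ.≤-<-trans ca≤cb (ℚ.+-monoʳ-< c b<a))

Shared : Schedule → Schedule → ℕ → ℕ → Set
Shared S B t t' = Σ Job λ j → (S t ≡ just j) × (B t' ≡ just j)

shared? : ∀ S B t t' → Dec (Shared S B t t')
shared? S B t t' with S t
... | nothing = no λ { (_ , () , _) }
... | just j with Maybe.≡-dec _≟J_ (B t') (just j)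
...   | yes Bt'≡j = yes (j , refl , Bt'≡j)
...   | no Bt'≢j = no λ { (_ , refl , Bt'≡j) → Bt'≢j Bt'≡j }

CarriedOver : ℕ → ℕ → Schedule → Schedule → Set
CarriedOver T n S B = ∃ λ t → t < n × ∃ λ t' → t' < T × n ≤ t' × Shared S B t t'

carriedOver? : ∀ T n S B → Dec (CarriedOver T n S B)
carriedOver? T n S B =
  ℕ.anyUpTo? (λ t → ℕ.anyUpTo? (λ t' → (n ≤? t') ×-dec shared? S B t t') T) n

splice : ℕ → Schedule → Schedule → Schedule
splice n S B t with t <? n
... | yes _ = S t
... | no _ = B t

splice-< : ∀ {n t} S B → t < n → splice n S B t ≡ S t
splice-< {n} {t} S B t<n with t <? n
... | yes _ = refl
... | no t≮n = ⊥-elim (t≮n t<n)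

splice-≥ : ∀ {n t} S B → n ≤ t → splice n S B t ≡ B t
splice-≥ {n} {t} S B n≤t with t <? n
... | yes t<n = ⊥-elim (ℕ.<⇒≱ t<n n≤t)
... | no _ = refl

Wbelow-cong : ∀ {S B} m → (∀ {t} → t < m → S t ≡ B t) → Wbelow S m ≡ Wbelow B m
Wbelow-cong zero     S≡B = refl
Wbelow-cong (suc m) S≡B = cong₂ _+_ (Wbelow-cong m (S≡B ∘ ℕ.m<n⇒m<1+n)) (cong wt (S≡B ℕ.≤-refl))

-- the splice identity, with both sides moved so that no subtraction occurs
Wbelow-splice : ∀ n S B k →
  Wbelow (splice n S B) (k ℕ.+ n) + Wbelow B n ≡ Wbelow S n + Wbelow B (k ℕ.+ n)
Wbelow-splice n S B zero = cong (_+ Wbelow B n) (Wbelow-cong n (splice-< S B))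
Wbelow-splice n S B (suc k) = begin
  (X + s) + b  ≡⟨ ℚ.+-assoc X s b ⟩
  X + (s + b)  ≡⟨ cong (X +_) (ℚ.+-comm s b) ⟩
  X + (b + s)  ≡⟨ sym (ℚ.+-assoc X b s) ⟩
  (X + b) + s  ≡⟨ cong (_+ s) (Wbelow-splice n S B k) ⟩
  (a + Y) + s  ≡⟨ ℚ.+-assoc a Y s ⟩
  a + (Y + s)  ≡⟨ cong (λ u → a + (Y + wt u)) (splice-≥ S B (ℕ.m≤n+m n k)) ⟩
  a + (Y + wt (B (k ℕ.+ n)))  ∎
  where
  open ≡-Reasoning
  X = Wbelow (splice n S B) (k ℕ.+ n)
  s = wt (splice n S B (k ℕ.+ n))
  b = Wbelow B n
  a = Wbelow S n
  Y = Wbelow B (k ℕ.+ n)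

splice-valid : ∀ {T I J n S B} → Valid T J S → Valid T I B →
  (∀ {t j} → t < n → S t ≡ just j → j ∈ I) →
  (∀ {t t'} → t < n → n ≤ t' → ¬ Shared S B t t') →
  Valid T I (splice n S B)
splice-valid {T} {I} {n = n} {S} {B} (feasS , injS) (feasB , injB) early disjoint = feas , inj
  where
  feas : ∀ t j → splice n S B t ≡ just j → (j ∈ I) × (r j ≤ t) × (t < d j) × (t < T)
  feas t j e with t <? n
  ... | yes t<n = early t<n e , proj₂ (feasS t j e)
  ... | no _    = feasB t j e
  inj : ∀ t t' j → splice n S B t ≡ just j → splice n S B t' ≡ just j → t ≡ t'
  inj t t' j e e' with t <? n | t' <? n
  ... | yes _   | yes _    = injS t t' j e e'
  ... | no _    | no _     = injB t t' j e e'
  ... | yes t<n | no t'≮n  = ⊥-elim (disjoint t<n (ℕ.≮⇒≥ t'≮n) (j , e , e'))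
  ... | no t≮n  | yes t'<n = ⊥-elim (disjoint t'<n (ℕ.≮⇒≥ t≮n) (j , e' , e))

prefix-exchange : ∀ {T I n S B} → Optimal T I B → n ≤ T → Valid T I (splice n S B) →
  Wbelow S n ≤ℚ Wbelow B n
prefix-exchange {T} {n = n} {S} {B} (_ , optimal) n≤T valid =
  +-cancelˡ-≤ (Wbelow S n) (Wbelow B n) (Wbelow B T) (begin
    Wbelow B T + Wbelow S n               ≡⟨ ℚ.+-comm (Wbelow B T) (Wbelow S n) ⟩
    Wbelow S n + Wbelow B T               ≡⟨ sym splice-identity ⟩
    Wbelow (splice n S B) T + Wbelow B n  ≤⟨ ℚ.+-monoˡ-≤ (Wbelow B n) (optimal _ valid) ⟩
    Wbelow B T + Wbelow B n               ∎)
  where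
  open ℚ.≤-Reasoning
  splice-identity : Wbelow (splice n S B) T + Wbelow B n ≡ Wbelow S n + Wbelow B T
  splice-identity = subst (λ m → Wbelow (splice n S B) m + Wbelow B n ≡ Wbelow S n + Wbelow B m)
    (ℕ.m∸n+n≡m n≤T) (Wbelow-splice n S B (T ∸ n))

lemma5 : (T : ℕ) (J Ĵ : List Job) (ρ : ℚ) (A : List Job → Schedule)
    (Ŝ : Schedule) (optS : ℕ → Schedule) (O : Schedule) (τ : ℕ) →
    WellFormed J → WellFormed Ĵ → 1ℚ ≤ℚ ρ → OnlineAlg T A →
    CanonOpt T Ĵ Ŝ →
    (∀ t → CanonOpt T (released≤ t J) (optS t)) →
    CanonOpt T J O →
    τ < T →
    Wle (optS τ) τ ≤ℚ ρ * Wle (LAP J Ŝ A optS ρ) τ →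
    (∀ t → τ < t → t < T → ¬ (Wle (optS t) t ≤ℚ ρ * Wle (LAP J Ŝ A optS ρ) t)) →
    Wle (optS τ) τ <ℚ Wle O τ →
    Σ Job λ j → Σ ℕ λ t₁ → Σ ℕ λ t₂ →
    (t₁ ≤ τ) × (τ < t₂) × (t₂ < T) × (O t₁ ≡ just j) × (optS τ t₂ ≡ just j)
lemma5 T J _ _ _ _ optS O τ _ _ _ _ _ optS-opt ((validO , _) , _) τ<T _ _ optS<O
  with carriedOver? T (suc τ) O (optS τ)
... | yes (t₁ , s≤s t₁≤τ , t₂ , t₂<T , τ<t₂ , j , Ot₁≡j , Bt₂≡j) =
  j , t₁ , t₂ , t₁≤τ , τ<t₂ , t₂<T , Ot₁≡j , Bt₂≡j
... | no ¬carried =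
  ⊥-elim (ℚ.<-irrefl refl (ℚ.<-≤-trans optS<O (prefix-exchange optimalB τ<T spliceValid)))
  where
  optimalB : Optimal T (released≤ τ J) (optS τ)
  optimalB = proj₁ (optS-opt τ)
  validB : Valid T (released≤ τ J) (optS τ)
  validB = proj₁ optimalB
  released : ∀ {t j} → t < suc τ → O t ≡ just j → j ∈ released≤ τ J
  released (s≤s t≤τ) Ot≡j with proj₁ validO _ _ Ot≡j
  ... | j∈J , r≤t , _ = ∈-released≤ J j∈J (ℕ.≤-trans r≤t t≤τ)
  disjoint : ∀ {t t'} → t < suc τ → τ < t' → ¬ Shared O (optS τ) t t'
  disjoint t≤τ τ<t' shared@(j , _ , Bt'≡j) with proj₁ validB _ j Bt'≡j
  ... | _ , _ , _ , t'<T = ¬carried (_ , t≤τ , _ , t'<T , τ<t' , shared)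
  spliceValid : Valid T (released≤ τ J) (splice (suc τ) O (optS τ))
  spliceValid = splice-valid validO validB released disjoint
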